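{- Let $(d_n)_{n\in\mathbb{N}}$ be the increasing sequence with $\{d_n\}=\{m\ge1: c_m=0\}$ and let $(v_n)_{n\in\mathbb{N}}$ be the increasing sequence with $\{v_n\}=\{m\in\mathbb{N}: q_m=0\}$. Then for all $n\in\mathbb{N}$, $$d_{2n}=2v_{n+1}-3,\qquad d_{2n+1}=2v_{n+1}-2.$$
   Context: The Thue--Morse sequence $(t_n)$ has $t_n$ equal to the sum of binary digits of $n$ modulo $2$, in $\mathbb{F}_2$. Let $C=\sum c_nX^n\in\mathbb{F}_2[[X]]$ be the composition inverse of $T=\sum t_nX^n$ (unique series with $T(C(X))=C(T(X))=X$). The Baum--Sweet sequence $(b_n)$ is defined by $b_0=1$ and, for $n\ge1$, $b_n=0$ if the binary expansion of $n$ contains a maximal block of $0$'s of odd length, $b_n=1$ otherwise. Let $D=\sum b''_nX^n\in\mathbb{F}_2[[X]]$ with $b''_0=0$, $b''_n=b_{n-1}$ ($n\ge1$), and let $Q=\sum q_nX^n$ be its composition inverse in $\mathbb{F}_2[[X]]$. -}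

module Defs where

open import Data.Bool using (Bool; true; false; not; _∧_; _xor_)
open import Data.List using (List; []; _∷_; foldr)
open import Data.Nat using (ℕ; zero; suc; _+_; _*_; _∸_; _≤_; _<_; _%_; _≡ᵇ_; ⌊_/2⌋)
open import Data.Product using (Σ; ∃; _×_)
open import Relation.Binary.PropositionalEquality using (_≡_)
open import Function.Bundles using (_⇔_)

-- Elements of 𝔽₂ are represented by Bool (false = 0, true = 1, xor = +, ∧ = ·).
-- A formal power series over 𝔽₂ is its coefficient sequence.
Series : Set
Series = ℕ → Bool

-- Binary digits (least significant first), computed with fuel n
-- (n has at most n binary digits, so fuel n is enough).

bitsF : ℕ → ℕ → List Bool
bitsF zero    _ = []
bitsF (suc f) zero = []
bitsF (suc f) (suc m) = ((suc m % 2) ≡ᵇ 1) ∷ bitsF f ⌊ suc m /2⌋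

bits : ℕ → List Bool
bits n = bitsF n n

thueMorse : ℕ → Bool
thueMorse n = foldr _xor_ false (bits n)

-- Scan the binary digits, tracking parity of the current block of 0's;
-- returns true iff every maximal block of 0's has even length.
evenZeroBlocks : Bool → List Bool → Bool
evenZeroBlocks p []           = not p
evenZeroBlocks p (false ∷ xs) = evenZeroBlocks (not p) xs
evenZeroBlocks p (true ∷ xs)  = not p ∧ evenZeroBlocks false xs

baumSweet : ℕ → Bool
baumSweet zero    = true
baumSweet (suc n) = evenZeroBlocks false (bits (suc n))

T : Series
T = thueMorse

D : Series
D zero    = false
D (suc n) = baumSweet n

sumTo : ℕ → (ℕ → Bool) → Bool
sumTo zero    f = f zero
sumTo (suc n) f = sumTo n f xor f (suc n)

mul : Series → Series → Series
mul f g n = sumTo n (λ i → f i ∧ g (n ∸ i))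

one : Series
one zero    = true
one (suc _) = false

X : Series
X (suc zero) = true
X _          = false

pow : Series → ℕ → Series
pow f zero    = one
pow f (suc k) = mul f (pow f k)

-- composition g(f(X)); meaningful when f has zero constant term,
-- in which case [Xⁿ] f^k = 0 for k > n, so the sum over k ≤ n is exact.
compose : Series → Series → Series
compose g f n = sumTo n (λ k → g k ∧ pow f k n)

IsCompInverse : Series → Series → Set
IsCompInverse F C = (C zero ≡ false) × (∀ n → compose F C n ≡ X n) × (∀ n → compose C F n ≡ X n)

IsIncreasingEnum : (ℕ → Set) → (ℕ → ℕ) → Set
IsIncreasingEnum P s = (∀ n → s n < s (suc n)) × (∀ m → P m ⇔ (∃ λ n → s n ≡ m))

module Submission where

-- Let Φ(f) = X((1+f)² + X(1+f)³).  The proof has four steps.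
--  (1) t_{2m} = t_m and t_{2m+1} = 1 + t_m give T(y) = (1+y)T(y)² + y/(1+y)²;
--      substituting y = C yields C = Φ(C)                        (ThueMorseInverse).
--  (2) b_{2m+1} = b_m, b_{4m} = b_m, b_{4m+2} = 0 give D⁴ + y³D² = y³D;
--      substituting y = Q yields (1+X)Q³ = X³                    (BaumSweetInverse).
--  (3) Then Z = Σ_{j≥2} Q_j (X^{2j−3} + X^{2j−2}) satisfies X³Z = (1+X)(Q+X)²,
--      and a ring computation gives Z = Φ(Z)                     (CandidateFixedPoint).
--  (4) Φ = X·R with R causal has only one fixed point, so C = Z: C_{k+1} = Q_{2+⌊k/2⌋}.
--      The zeros of C of positive degree thus come in pairs 2v−3, 2v−2, one for each
--      zero v ≥ 2 of Q, which is the theorem after comparing increasing enumerations.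
-- Substitution into a series is only defined coefficientwise (`compose`), so (1) and
-- (2) are done on truncated compositions, using that agreement up to degree n is a
-- congruence.

open import Defs
open import Data.Bool using (Bool; true; false; not; _∧_; _xor_; if_then_else_)
open import Data.Bool.Properties
  using (xor-assoc; xor-comm; xor-identityʳ; xor-same; xor-∧-commutativeRing;
         ∧-assoc; ∧-comm; ∧-idem; ∧-zeroʳ; ∧-distribˡ-xor; ∧-distribʳ-xor)
open import Data.List using (_∷_; foldr)
open import Data.Nat using (ℕ; zero; suc; pred; _+_; _*_; _∸_; _≤_; _<_; z≤n; s≤s; s≤s⁻¹; _%_; _≡ᵇ_; ⌊_/2⌋)
open import Data.Nat.Properties
  using (≤-refl; ≤-trans; ≤-antisym; ≤-<-trans; <⇒≤; <⇒≱; ≮⇒≥; _<?_; n≤1+n; n<1+n; m≤n⇒m≤1+n;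
         m≤n⇒m<n∨m≡n; n≤0⇒n≡0; n∸n≡0; +-∸-assoc; m∸n≤m; ∸-monoˡ-<; +-identityʳ; +-comm; *-suc; ⌊n/2⌋<n)
open import Data.Sum using (inj₁; inj₂)
open import Data.Product using (Σ; ∃; _×_; _,_; proj₁)
open import Algebra.Bundles using (CommutativeSemiring; CommutativeRing; RawRing)
open import Algebra.Solver.Ring.AlmostCommutativeRing
  using (AlmostCommutativeRing; fromCommutativeSemiring; _-Raw-AlmostCommutative⟶_)
open import Algebra.Properties.CommutativeSemigroup
  (CommutativeRing.+-commutativeSemigroup xor-∧-commutativeRing)
  using () renaming (interchange to xor-interchange)
open import Data.Maybe using (Maybe; just; nothing)
open import Function using (id; _∘_)
open import Function.Bundles using (_⇔_; mk⇔; Equivalence)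
open import Function.Properties.Equivalence using () renaming (sym to ⇔-sym; trans to ⇔-trans)
open import Relation.Nullary using (¬_; yes; no; contradiction)
import Relation.Binary.Reasoning.Setoid
open import Level using (0ℓ)
open import Relation.Binary.PropositionalEquality
  using (_≡_; refl; sym; trans; cong; cong₂; subst; subst₂; module ≡-Reasoning)

sumTo-cong : ∀ n {F G : ℕ → Bool} → (∀ i → i ≤ n → F i ≡ G i) → sumTo n F ≡ sumTo n G
sumTo-cong zero    F≡G = F≡G 0 z≤n
sumTo-cong (suc n) F≡G =
  cong₂ _xor_ (sumTo-cong n (λ i i≤n → F≡G i (m≤n⇒m≤1+n i≤n))) (F≡G (suc n) ≤-refl)

sumTo-zero : ∀ n {F : ℕ → Bool} → (∀ i → i ≤ n → F i ≡ false) → sumTo n F ≡ false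
sumTo-zero zero    F≡0 = F≡0 0 z≤n
sumTo-zero (suc n) F≡0 =
  cong₂ _xor_ (sumTo-zero n (λ i i≤n → F≡0 i (m≤n⇒m≤1+n i≤n))) (F≡0 (suc n) ≤-refl)

sumTo-head : ∀ n (F : ℕ → Bool) → sumTo (suc n) F ≡ F 0 xor sumTo n (λ i → F (suc i))
sumTo-head zero    F = refl
sumTo-head (suc n) F =
  trans (cong (_xor F (suc (suc n))) (sumTo-head n F))
        (xor-assoc (F 0) (sumTo n (λ i → F (suc i))) (F (suc (suc n))))

sumTo-xor : ∀ n (F G : ℕ → Bool) → sumTo n (λ i → F i xor G i) ≡ sumTo n F xor sumTo n G
sumTo-xor zero    F G = refl
sumTo-xor (suc n) F G =
  trans (cong (_xor (F (suc n) xor G (suc n))) (sumTo-xor n F G))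
        (xor-interchange (sumTo n F) (sumTo n G) (F (suc n)) (G (suc n)))

sumTo-scale : ∀ n b (F : ℕ → Bool) → sumTo n (λ i → b ∧ F i) ≡ b ∧ sumTo n F
sumTo-scale zero    b F = refl
sumTo-scale (suc n) b F =
  trans (cong (_xor (b ∧ F (suc n))) (sumTo-scale n b F))
        (sym (∧-distribˡ-xor b (sumTo n F) (F (suc n))))

infix  4 _≈_
infixl 6 _⊕_
infixl 7 _⊗_

_≈_ : Series → Series → Set
f ≈ g = ∀ n → f n ≡ g n

zeroS : Series
zeroS _ = false

_⊕_ : Series → Series → Series
(f ⊕ g) n = f n xor g n

_⊗_ : Series → Series → Series
_⊗_ = mul

shift : Series → Series
shift f n = f (suc n)

⊕-cong : ∀ {f f′ g g′} → f ≈ f′ → g ≈ g′ → f ⊕ g ≈ f′ ⊕ g′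
⊕-cong f≈f′ g≈g′ n = cong₂ _xor_ (f≈f′ n) (g≈g′ n)

mul-cong≤ : ∀ n {f f′ g g′} → (∀ i → i ≤ n → f i ≡ f′ i) → (∀ i → i ≤ n → g i ≡ g′ i) →
            (f ⊗ g) n ≡ (f′ ⊗ g′) n
mul-cong≤ n f≡f′ g≡g′ = sumTo-cong n (λ i i≤n → cong₂ _∧_ (f≡f′ i i≤n) (g≡g′ (n ∸ i) (m∸n≤m n i)))

⊗-cong : ∀ {f f′ g g′} → f ≈ f′ → g ≈ g′ → f ⊗ g ≈ f′ ⊗ g′
⊗-cong f≈f′ g≈g′ n = mul-cong≤ n (λ i _ → f≈f′ i) (λ i _ → g≈g′ i)

mul-suc-left : ∀ f g n → (f ⊗ g) (suc n) ≡ (f 0 ∧ g (suc n)) xor (shift f ⊗ g) n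
mul-suc-left f g n = sumTo-head n (λ i → f i ∧ g (suc n ∸ i))

mul-suc-right : ∀ f g n → (f ⊗ g) (suc n) ≡ (f ⊗ shift g) n xor (f (suc n) ∧ g 0)
mul-suc-right f g n = cong₂ _xor_
  (sumTo-cong n (λ i i≤n → cong (λ k → f i ∧ g k) (+-∸-assoc 1 i≤n)))
  (cong (λ k → f (suc n) ∧ g k) (n∸n≡0 n))

mul-comm : ∀ f g → f ⊗ g ≈ g ⊗ f
mul-comm f g zero    = ∧-comm (f 0) (g 0)
mul-comm f g (suc n) = begin
  (f ⊗ g) (suc n)                          ≡⟨ mul-suc-right f g n ⟩
  (f ⊗ shift g) n xor (f (suc n) ∧ g 0)    ≡⟨ cong₂ _xor_ (mul-comm f (shift g) n) (∧-comm (f (suc n)) (g 0)) ⟩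
  (shift g ⊗ f) n xor (g 0 ∧ f (suc n))    ≡⟨ xor-comm ((shift g ⊗ f) n) (g 0 ∧ f (suc n)) ⟩
  (g 0 ∧ f (suc n)) xor (shift g ⊗ f) n    ≡⟨ mul-suc-left g f n ⟨
  (g ⊗ f) (suc n)                          ∎
  where open ≡-Reasoning

mul-zeroˡ : ∀ g → zeroS ⊗ g ≈ zeroS
mul-zeroˡ g n = sumTo-zero n (λ _ _ → refl)

mul-zeroʳ : ∀ g → g ⊗ zeroS ≈ zeroS
mul-zeroʳ g n = trans (mul-comm g zeroS n) (mul-zeroˡ g n)

mul-identityˡ : ∀ f → one ⊗ f ≈ f
mul-identityˡ f zero    = refl
mul-identityˡ f (suc n) = trans (mul-suc-left one f n) (trans (cong (f (suc n) xor_) (mul-zeroˡ f n)) (xor-identityʳ _))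

mul-identityʳ : ∀ f → f ⊗ one ≈ f
mul-identityʳ f n = trans (mul-comm f one n) (mul-identityˡ f n)

mul-distribʳ : ∀ f g h → (f ⊕ g) ⊗ h ≈ f ⊗ h ⊕ g ⊗ h
mul-distribʳ f g h n =
  trans (sumTo-cong n (λ i _ → ∧-distribʳ-xor (h (n ∸ i)) (f i) (g i))) (sumTo-xor n _ _)

mul-distribˡ : ∀ f g h → f ⊗ (g ⊕ h) ≈ f ⊗ g ⊕ f ⊗ h
mul-distribˡ f g h n =
  trans (mul-comm f (g ⊕ h) n) (trans (mul-distribʳ g h f n) (cong₂ _xor_ (mul-comm g f n) (mul-comm h f n)))

mul-scale : ∀ b f g → (λ i → b ∧ f i) ⊗ g ≈ λ n → b ∧ (f ⊗ g) n
mul-scale b f g n = trans (sumTo-cong n (λ i _ → ∧-assoc b (f i) (g (n ∸ i)))) (sumTo-scale n b _)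

mul-assoc : ∀ f g h → (f ⊗ g) ⊗ h ≈ f ⊗ (g ⊗ h)
mul-assoc f g h zero    = ∧-assoc (f 0) (g 0) (h 0)
mul-assoc f g h (suc n) = begin
  ((f ⊗ g) ⊗ h) (suc n)
    ≡⟨ mul-suc-left (f ⊗ g) h n ⟩
  ((f 0 ∧ g 0) ∧ h (suc n)) xor (shift (f ⊗ g) ⊗ h) n
    ≡⟨ cong₂ _xor_ (∧-assoc (f 0) (g 0) (h (suc n)))
                   (⊗-cong {g = h} (mul-suc-left f g) (λ _ → refl) n) ⟩
  (f 0 ∧ (g 0 ∧ h (suc n))) xor (((λ i → f 0 ∧ shift g i) ⊕ shift f ⊗ g) ⊗ h) n
    ≡⟨ cong (a xor_) (mul-distribʳ (λ i → f 0 ∧ shift g i) (shift f ⊗ g) h n) ⟩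
  a xor (((λ i → f 0 ∧ shift g i) ⊗ h) n xor ((shift f ⊗ g) ⊗ h) n)
    ≡⟨ cong (a xor_) (cong₂ _xor_ (mul-scale (f 0) (shift g) h n) (mul-assoc (shift f) g h n)) ⟩
  a xor ((f 0 ∧ (shift g ⊗ h) n) xor (shift f ⊗ (g ⊗ h)) n)
    ≡⟨ xor-assoc a _ _ ⟨
  (a xor (f 0 ∧ (shift g ⊗ h) n)) xor (shift f ⊗ (g ⊗ h)) n
    ≡⟨ cong (_xor (shift f ⊗ (g ⊗ h)) n) (∧-distribˡ-xor (f 0) _ _) ⟨
  (f 0 ∧ ((g 0 ∧ h (suc n)) xor (shift g ⊗ h) n)) xor (shift f ⊗ (g ⊗ h)) n
    ≡⟨ cong (λ z → (f 0 ∧ z) xor (shift f ⊗ (g ⊗ h)) n) (mul-suc-left g h n) ⟨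
  (f 0 ∧ (g ⊗ h) (suc n)) xor (shift f ⊗ (g ⊗ h)) n
    ≡⟨ mul-suc-left f (g ⊗ h) n ⟨
  (f ⊗ (g ⊗ h)) (suc n) ∎
  where
  open ≡-Reasoning
  a : Bool
  a = f 0 ∧ (g 0 ∧ h (suc n))

seriesSemiring : CommutativeSemiring 0ℓ 0ℓ
seriesSemiring = record
  { Carrier = Series ; _≈_ = _≈_ ; _+_ = _⊕_ ; _*_ = _⊗_ ; 0# = zeroS ; 1# = one
  ; isCommutativeSemiring = record
    { isSemiring = record
      { isSemiringWithoutAnnihilatingZero = record
        { +-isCommutativeMonoid = record
          { isMonoid = record
            { isSemigroup = record
              { isMagma = record
                { isEquivalence = record
                  { refl = λ _ → refl ; sym = λ p n → sym (p n) ; trans = λ p q n → trans (p n) (q n) }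
                ; ∙-cong = ⊕-cong }
              ; assoc = λ f g h n → xor-assoc (f n) (g n) (h n) }
            ; identity = (λ f n → refl) , (λ f n → xor-identityʳ (f n)) }
          ; comm = λ f g n → xor-comm (f n) (g n) }
        ; *-cong = ⊗-cong
        ; *-assoc = mul-assoc
        ; *-identity = mul-identityˡ , mul-identityʳ
        ; distrib = mul-distribˡ , λ h f g → mul-distribʳ f g h }
      ; zero = mul-zeroˡ , mul-zeroʳ }
    ; *-comm = mul-comm } }

open CommutativeSemiring seriesSemiring
  using (setoid) renaming (refl to ≈-refl; sym to ≈-sym; trans to ≈-trans)

module ≈-Reasoning = Relation.Binary.Reasoning.Setoid setoid

module SeriesSolver where

  const : Bool → Series
  const b = if b then one else zeroS

  const-xor : ∀ a b → const (a xor b) ≈ const a ⊕ const b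
  const-xor false b     n       = refl
  const-xor true  false n       = sym (xor-identityʳ (one n))
  const-xor true  true  zero    = refl
  const-xor true  true  (suc n) = refl

  private
    seriesACR : AlmostCommutativeRing 0ℓ 0ℓ
    seriesACR = fromCommutativeSemiring seriesSemiring

    boolRawRing : RawRing 0ℓ 0ℓ
    boolRawRing = record
      { Carrier = Bool ; _≈_ = _≡_ ; _+_ = _xor_ ; _*_ = _∧_ ; -_ = id ; 0# = false ; 1# = true }

    const-∧ : ∀ a b → const (a ∧ b) ≈ const a ⊗ const b
    const-∧ false b     n = sym (mul-zeroˡ (const b) n)
    const-∧ true  false n = sym (mul-zeroʳ one n)
    const-∧ true  true  n = sym (mul-identityˡ one n)

    const-hom : boolRawRing -Raw-AlmostCommutative⟶ seriesACR
    const-hom = record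
      { ⟦_⟧ = const ; +-homo = const-xor ; *-homo = const-∧
      ; -‿homo = λ _ _ → refl ; 0-homo = λ _ → refl ; 1-homo = λ _ → refl }

    const-equal? : ∀ a b → Maybe (const a ≈ const b)
    const-equal? false false = just (λ _ → refl)
    const-equal? true  true  = just (λ _ → refl)
    const-equal? _     _     = nothing

  open import Algebra.Solver.Ring boolRawRing seriesACR const-hom const-equal? public

open SeriesSolver using (const; const-xor; solve; _:+_; _:*_; _:^_; _:=_; con)

mulX-suc : ∀ g n → (X ⊗ g) (suc n) ≡ g n
mulX-suc g n = trans (mul-suc-left X g n) (trans (⊗-cong {g = g} shift-X (λ _ → refl) n) (mul-identityˡ g n))
  where
  shift-X : shift X ≈ one
  shift-X zero    = refl
  shift-X (suc n) = refl

mulX²-suc : ∀ g n → (X ⊗ (X ⊗ g)) (suc (suc n)) ≡ g n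
mulX²-suc g n = trans (mulX-suc (X ⊗ g) (suc n)) (mulX-suc g n)

cancelX : ∀ {f g} → X ⊗ f ≈ X ⊗ g → f ≈ g
cancelX {f} {g} Xf≈Xg n = trans (sym (mulX-suc f n)) (trans (Xf≈Xg (suc n)) (mulX-suc g n))

const-zero : ∀ b → const b 0 ≡ b
const-zero false = refl
const-zero true  = refl

const-suc : ∀ b n → const b (suc n) ≡ false
const-suc false n = refl
const-suc true  n = refl

split-constant : ∀ f → f ≈ const (f 0) ⊕ X ⊗ shift f
split-constant f zero    = sym (trans (xor-identityʳ (const (f 0) 0)) (const-zero (f 0)))
split-constant f (suc n) = sym (cong₂ _xor_ (const-suc (f 0) n) (mulX-suc (shift f) n))

mul-const : ∀ b h n → (const b ⊗ h) n ≡ b ∧ h n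
mul-const false h n = mul-zeroˡ h n
mul-const true  h n = mul-identityˡ h n

const-idem : ∀ b → const b ⊗ const b ≈ const b
const-idem false n = mul-zeroˡ zeroS n
const-idem true  n = mul-identityˡ one n

const-cong : ∀ {a b} → a ≡ b → const a ≈ const b
const-cong refl _ = refl

-- Squaring in characteristic 2 (Frobenius): (Σ fₙ Xⁿ)² = Σ fₙ X²ⁿ.

double : ℕ → ℕ
double zero    = zero
double (suc m) = suc (suc (double m))

square : Series → Series
square f = f ⊗ f

square-split : ∀ f → square f ≈ const (f 0) ⊕ X ⊗ (X ⊗ square (shift f))
square-split f = ≈-trans (⊗-cong (split-constant f) (split-constant f))
  (≈-trans (solve 3 (λ c x g → (c :+ x :* g) :* (c :+ x :* g) := c :* c :+ x :* (x :* (g :* g)))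
                    (λ _ → refl) (const (f 0)) X (shift f))
           (⊕-cong (const-idem (f 0)) ≈-refl))

square-even : ∀ f m → square f (double m) ≡ f m
square-even f zero    = trans (square-split f 0) (trans (xor-identityʳ _) (const-zero (f 0)))
square-even f (suc m) = begin
  square f (double (suc m))
    ≡⟨ square-split f (double (suc m)) ⟩
  const (f 0) (double (suc m)) xor (X ⊗ (X ⊗ square (shift f))) (double (suc m))
    ≡⟨ cong₂ _xor_ (const-suc (f 0) (suc (double m))) (mulX²-suc (square (shift f)) (double m)) ⟩
  square (shift f) (double m)
    ≡⟨ square-even (shift f) m ⟩
  f (suc m) ∎
  where open ≡-Reasoning

square-odd : ∀ f m → square f (suc (double m)) ≡ false
square-odd f zero    = trans (square-split f 1) (cong₂ _xor_ (const-suc (f 0) 0) (mulX-suc (X ⊗ square (shift f)) 0))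
square-odd f (suc m) = begin
  square f (suc (double (suc m)))
    ≡⟨ square-split f (suc (double (suc m))) ⟩
  const (f 0) (suc (double (suc m))) xor (X ⊗ (X ⊗ square (shift f))) (suc (double (suc m)))
    ≡⟨ cong₂ _xor_ (const-suc (f 0) (suc (suc (double m)))) (mulX²-suc (square (shift f)) (suc (double m))) ⟩
  square (shift f) (suc (double m))
    ≡⟨ square-odd (shift f) m ⟩
  false ∎
  where open ≡-Reasoning

pow-double : ∀ f k → pow f (double k) ≈ square (pow f k)
pow-double f zero    = ≈-sym (mul-identityˡ one)
pow-double f (suc k) = ≈-trans (⊗-cong ≈-refl (⊗-cong ≈-refl (pow-double f k)))
  (solve 2 (λ a p → a :* (a :* (p :* p)) := (a :* p) :* (a :* p)) (λ _ → refl) f (pow f k))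

-- Agreement of two series up to degree n.  It is a congruence for ⊕ and ⊗,
-- which is what lets truncated partial sums stand in for infinite ones.

infix 4 _≃[_]_

_≃[_]_ : Series → ℕ → Series → Set
f ≃[ n ] g = ∀ i → i ≤ n → f i ≡ g i

≈⇒≃ : ∀ {f g} n → f ≈ g → f ≃[ n ] g
≈⇒≃ n f≈g i _ = f≈g i

≃-refl : ∀ {f n} → f ≃[ n ] f
≃-refl _ _ = refl

≃-sym : ∀ {f g n} → f ≃[ n ] g → g ≃[ n ] f
≃-sym f≃g i i≤n = sym (f≃g i i≤n)

≃-trans : ∀ {f g h n} → f ≃[ n ] g → g ≃[ n ] h → f ≃[ n ] h
≃-trans f≃g g≃h i i≤n = trans (f≃g i i≤n) (g≃h i i≤n)

⊕-cong≃ : ∀ {f f′ g g′ n} → f ≃[ n ] f′ → g ≃[ n ] g′ → f ⊕ g ≃[ n ] f′ ⊕ g′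
⊕-cong≃ f≃f′ g≃g′ i i≤n = cong₂ _xor_ (f≃f′ i i≤n) (g≃g′ i i≤n)

⊗-cong≃ : ∀ {f f′ g g′ n} → f ≃[ n ] f′ → g ≃[ n ] g′ → f ⊗ g ≃[ n ] f′ ⊗ g′
⊗-cong≃ f≃f′ g≃g′ i i≤n =
  mul-cong≤ i (λ j j≤i → f≃f′ j (≤-trans j≤i i≤n)) (λ j j≤i → g≃g′ j (≤-trans j≤i i≤n))

pow-vanish : ∀ f k m → f 0 ≡ false → m < k → pow f k m ≡ false
pow-vanish f (suc k) zero    f₀≡0 _         = cong (_∧ pow f k 0) f₀≡0
pow-vanish f (suc k) (suc m) f₀≡0 (s≤s m<k) = begin
  (f ⊗ pow f k) (suc m)
    ≡⟨ mul-suc-left f (pow f k) m ⟩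
  (f 0 ∧ pow f k (suc m)) xor (shift f ⊗ pow f k) m
    ≡⟨ cong (λ b → (b ∧ pow f k (suc m)) xor (shift f ⊗ pow f k) m) f₀≡0 ⟩
  (shift f ⊗ pow f k) m
    ≡⟨ mul-cong≤ m (λ _ _ → refl) low-terms ⟩
  (shift f ⊗ zeroS) m
    ≡⟨ mul-zeroʳ (shift f) m ⟩
  false ∎
  where
  open ≡-Reasoning
  low-terms : ∀ j → j ≤ m → pow f k j ≡ zeroS j
  low-terms j j≤m = pow-vanish f k j f₀≡0 (≤-trans (s≤s j≤m) m<k)

partialSum : ℕ → (ℕ → Series) → Series
partialSum zero    F = zeroS
partialSum (suc K) F = partialSum K F ⊕ F K

partialSum-cong : ∀ K {F G} → (∀ k → F k ≈ G k) → partialSum K F ≈ partialSum K G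
partialSum-cong zero    F≈G = ≈-refl
partialSum-cong (suc K) F≈G = ⊕-cong (partialSum-cong K F≈G) (F≈G K)

partialSum-⊕ : ∀ K F G → partialSum K (λ k → F k ⊕ G k) ≈ partialSum K F ⊕ partialSum K G
partialSum-⊕ zero    F G n = refl
partialSum-⊕ (suc K) F G = ≈-trans (⊕-cong (partialSum-⊕ K F G) ≈-refl)
  (solve 4 (λ a b c d → (a :+ b) :+ (c :+ d) := (a :+ c) :+ (b :+ d)) (λ _ → refl)
           (partialSum K F) (partialSum K G) (F K) (G K))

partialSum-⊗ : ∀ K h F → h ⊗ partialSum K F ≈ partialSum K (λ k → h ⊗ F k)
partialSum-⊗ zero    h F = mul-zeroʳ h
partialSum-⊗ (suc K) h F = ≈-trans (mul-distribˡ h (partialSum K F) (F K)) (⊕-cong (partialSum-⊗ K h F) ≈-refl)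

partialSum-square : ∀ K F → square (partialSum K F) ≈ partialSum K (λ k → square (F k))
partialSum-square zero    F n = mul-zeroˡ zeroS n
partialSum-square (suc K) F = ≈-trans
  (solve 2 (λ a b → (a :+ b) :* (a :+ b) := a :* a :+ b :* b) (λ _ → refl) (partialSum K F) (F K))
  (⊕-cong (partialSum-square K F) ≈-refl)

partialSum-pairs : ∀ M F → partialSum (double M) F ≈ partialSum M (λ m → F (double m) ⊕ F (suc (double m)))
partialSum-pairs zero    F = ≈-refl
partialSum-pairs (suc M) F = ≈-trans
  (solve 3 (λ s a b → (s :+ a) :+ b := s :+ (a :+ b)) (λ _ → refl)
           (partialSum (double M) F) (F (double M)) (F (suc (double M))))
  (⊕-cong (partialSum-pairs M F) ≈-refl)

partialSum-head : ∀ K F → partialSum (suc K) F ≈ F 0 ⊕ partialSum K (λ k → F (suc k))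
partialSum-head zero    F n = sym (xor-identityʳ (F 0 n))
partialSum-head (suc K) F = ≈-trans (⊕-cong (partialSum-head K F) ≈-refl)
  (solve 3 (λ a s b → (a :+ s) :+ b := a :+ (s :+ b)) (λ _ → refl)
           (F 0) (partialSum K (λ k → F (suc k))) (F (suc K)))

partialSum-coeff : ∀ m F n → partialSum (suc m) F n ≡ sumTo m (λ k → F k n)
partialSum-coeff zero    F n = refl
partialSum-coeff (suc m) F n = cong (_xor F (suc m) n) (partialSum-coeff m F n)

geometric-sum : ∀ C M → (one ⊕ C) ⊗ partialSum M (pow C) ≈ one ⊕ pow C M
geometric-sum C zero n = trans (mul-zeroʳ (one ⊕ C) n) (sym (xor-same (one n)))
geometric-sum C (suc M) = ≈-trans
  (solve 3 (λ c g p → (con true :+ c) :* (g :+ p) := (con true :+ c) :* g :+ p :+ c :* p) (λ _ → refl)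
           C (partialSum M (pow C)) (pow C M))
  (≈-trans (⊕-cong (⊕-cong (geometric-sum C M) ≈-refl) ≈-refl)
           (solve 2 (λ c p → con true :+ p :+ p :+ c :* p := con true :+ c :* p) (λ _ → refl) C (pow C M)))

partialComp : Series → Series → ℕ → Series
partialComp g f K = partialSum K (λ k → const (g k) ⊗ pow f k)

partialComp≃compose : ∀ g f K n → f 0 ≡ false → n < K → partialComp g f K n ≡ compose g f n
partialComp≃compose g f (suc K) n f₀≡0 (s≤s n≤K) with m≤n⇒m<n∨m≡n n≤K
... | inj₁ n<K = begin
  partialComp g f K n xor (const (g K) ⊗ pow f K) n
    ≡⟨ cong (partialComp g f K n xor_) (trans (mul-const (g K) (pow f K) n)
         (trans (cong (g K ∧_) (pow-vanish f K n f₀≡0 n<K)) (∧-zeroʳ (g K)))) ⟩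
  partialComp g f K n xor false
    ≡⟨ xor-identityʳ _ ⟩
  partialComp g f K n
    ≡⟨ partialComp≃compose g f K n f₀≡0 n<K ⟩
  compose g f n ∎
  where open ≡-Reasoning
... | inj₂ refl = trans (partialSum-coeff n (λ k → const (g k) ⊗ pow f k) n)
                        (sumTo-cong n (λ k _ → mul-const (g k) (pow f k) n))

double-half : ∀ m → ⌊ double m /2⌋ ≡ m
double-half zero    = refl
double-half (suc m) = cong suc (double-half m)

suc-double-half : ∀ m → ⌊ suc (double m) /2⌋ ≡ m
suc-double-half zero    = refl
suc-double-half (suc m) = cong suc (suc-double-half m)

double-mod2 : ∀ m → double m % 2 ≡ 0
double-mod2 zero    = refl
double-mod2 (suc m) = double-mod2 m

suc-double-mod2 : ∀ m → suc (double m) % 2 ≡ 1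
suc-double-mod2 zero    = refl
suc-double-mod2 (suc m) = suc-double-mod2 m

double≡2* : ∀ m → double m ≡ 2 * m
double≡2* zero    = refl
double≡2* (suc m) = trans (cong (suc ∘ suc) (double≡2* m)) (sym (*-suc 2 m))

double-mono-< : ∀ {a b} → a < b → suc (double a) < double b
double-mono-< {a} {suc b} (s≤s a≤b) = s≤s (s≤s (double-mono-≤ a≤b))
  where
  double-mono-≤ : ∀ {a b} → a ≤ b → double a ≤ double b
  double-mono-≤ z≤n       = z≤n
  double-mono-≤ (s≤s a≤b) = s≤s (s≤s (double-mono-≤ a≤b))

m≤double : ∀ m → m ≤ double m
m≤double zero    = z≤n
m≤double (suc m) = s≤s (m≤n⇒m≤1+n (m≤double m))

bitsF-fuel : ∀ f g m → m ≤ f → m ≤ g → bitsF f m ≡ bitsF g m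
bitsF-fuel zero    zero    m       _         _         = refl
bitsF-fuel zero    (suc g) zero    _         _         = refl
bitsF-fuel (suc f) zero    zero    _         _         = refl
bitsF-fuel (suc f) (suc g) zero    _         _         = refl
bitsF-fuel (suc f) (suc g) (suc m) (s≤s m≤f) (s≤s m≤g) =
  cong (((suc m % 2) ≡ᵇ 1) ∷_) (bitsF-fuel f g ⌊ suc m /2⌋ (≤-trans half≤m m≤f) (≤-trans half≤m m≤g))
  where
  half≤m : ⌊ suc m /2⌋ ≤ m
  half≤m = s≤s⁻¹ (⌊n/2⌋<n m)

bits-odd : ∀ m → bits (suc (double m)) ≡ true ∷ bits m
bits-odd m = begin
  ((suc (double m) % 2) ≡ᵇ 1) ∷ bitsF (double m) ⌊ suc (double m) /2⌋
    ≡⟨ cong₂ (λ r h → (r ≡ᵇ 1) ∷ bitsF (double m) h) (suc-double-mod2 m) (suc-double-half m) ⟩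
  true ∷ bitsF (double m) m
    ≡⟨ cong (true ∷_) (bitsF-fuel (double m) m m (m≤double m) ≤-refl) ⟩
  true ∷ bits m ∎
  where open ≡-Reasoning

bits-even : ∀ m → bits (double (suc m)) ≡ false ∷ bits (suc m)
bits-even m = begin
  ((double (suc m) % 2) ≡ᵇ 1) ∷ bitsF (suc (double m)) ⌊ double (suc m) /2⌋
    ≡⟨ cong₂ (λ r h → (r ≡ᵇ 1) ∷ bitsF (suc (double m)) h) (double-mod2 (suc m)) (double-half (suc m)) ⟩
  false ∷ bitsF (suc (double m)) (suc m)
    ≡⟨ cong (false ∷_) (bitsF-fuel (suc (double m)) (suc m) (suc m) (s≤s (m≤double m)) ≤-refl) ⟩
  false ∷ bits (suc m) ∎
  where open ≡-Reasoning

thueMorse-even : ∀ m → thueMorse (double m) ≡ thueMorse m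
thueMorse-even zero    = refl
thueMorse-even (suc m) = cong (foldr _xor_ false) (bits-even m)

thueMorse-odd : ∀ m → thueMorse (suc (double m)) ≡ not (thueMorse m)
thueMorse-odd m = cong (foldr _xor_ false) (bits-odd m)

baumSweet-odd : ∀ m → baumSweet (suc (double m)) ≡ baumSweet m
baumSweet-odd zero    = refl
baumSweet-odd (suc m) = cong (evenZeroBlocks false) (bits-odd (suc m))

baumSweet-4m : ∀ m → baumSweet (double (double m)) ≡ baumSweet m
baumSweet-4m zero    = refl
baumSweet-4m (suc m) = begin
  evenZeroBlocks false (bits (double (suc (suc (double m)))))
    ≡⟨ cong (evenZeroBlocks false) (bits-even (suc (double m))) ⟩
  evenZeroBlocks false (false ∷ bits (double (suc m)))
    ≡⟨ cong (λ ds → evenZeroBlocks false (false ∷ ds)) (bits-even m) ⟩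
  evenZeroBlocks false (bits (suc m)) ∎
  where open ≡-Reasoning

baumSweet-4m+2 : ∀ m → baumSweet (double (suc (double m))) ≡ false
baumSweet-4m+2 m = begin
  evenZeroBlocks false (bits (double (suc (double m))))
    ≡⟨ cong (evenZeroBlocks false) (bits-even (double m)) ⟩
  evenZeroBlocks false (false ∷ bits (suc (double m)))
    ≡⟨ cong (λ ds → evenZeroBlocks false (false ∷ ds)) (bits-odd m) ⟩
  false ∎
  where open ≡-Reasoning

R : Series → Series
R f = square (one ⊕ f) ⊕ X ⊗ ((one ⊕ f) ⊗ square (one ⊕ f))

Φ : Series → Series
Φ f = X ⊗ R f

vanish-⊗ : ∀ h {e n} → e ≃[ n ] zeroS → h ⊗ e ≃[ n ] zeroS
vanish-⊗ h {e} {n} e≃0 = ≃-trans (⊗-cong≃ ≃-refl e≃0) (≈⇒≃ n (mul-zeroʳ h))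

difference-vanishes : ∀ {f g n} → f ≃[ n ] g → f ⊕ g ≃[ n ] zeroS
difference-vanishes {f} {g} f≃g i i≤n = trans (cong (_xor g i) (f≃g i i≤n)) (xor-same (g i))

xor-cancel : ∀ a b → a xor b ≡ false → a ≡ b
xor-cancel false false _ = refl
xor-cancel true  true  _ = refl

-- Halving the Thue–Morse series: since t_{2m} = t_m and t_{2m+1} = 1 + t_m,
-- T(y) = T(y)² + y (G(y)² + T(y)²) with G = Σ yᵐ; here for truncations.

thueMorse-pair : ∀ f m →
  const (T (double m)) ⊗ pow f (double m) ⊕ const (T (suc (double m))) ⊗ pow f (suc (double m))
  ≈ square (const (T m) ⊗ pow f m) ⊕ f ⊗ (square (pow f m) ⊕ square (const (T m) ⊗ pow f m))
thueMorse-pair f m = ≈-trans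
  (⊕-cong (⊗-cong (≈-trans (const-cong (thueMorse-even m)) (≈-sym (const-idem (T m)))) (pow-double f m))
          (⊗-cong (≈-trans (const-cong (thueMorse-odd m)) t₂ₘ₊₁) (⊗-cong ≈-refl (pow-double f m))))
  (solve 3 (λ c p x → (c :* c) :* (p :* p) :+ (con true :+ c :* c) :* (x :* (p :* p))
                      := (c :* p) :* (c :* p) :+ x :* ((p :* p) :+ (c :* p) :* (c :* p)))
           (λ _ → refl) (const (T m)) (pow f m) f)
  where
  t₂ₘ₊₁ : const (not (T m)) ≈ one ⊕ const (T m) ⊗ const (T m)
  t₂ₘ₊₁ = ≈-trans (const-xor true (T m)) (⊕-cong (≈-refl {one}) (≈-sym (const-idem (T m))))

thueMorse-partialComp : ∀ f M →
  partialComp T f (double M) ≈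
  square (partialComp T f M) ⊕ f ⊗ (square (partialSum M (pow f)) ⊕ square (partialComp T f M))
thueMorse-partialComp f M = begin
  partialComp T f (double M)
    ≈⟨ partialSum-pairs M (λ k → const (T k) ⊗ pow f k) ⟩
  partialSum M (λ m → a (double m) ⊕ a (suc (double m)))
    ≈⟨ partialSum-cong M (thueMorse-pair f) ⟩
  partialSum M (λ m → square (a m) ⊕ f ⊗ (square (pow f m) ⊕ square (a m)))
    ≈⟨ partialSum-⊕ M (λ m → square (a m)) (λ m → f ⊗ (square (pow f m) ⊕ square (a m))) ⟩
  partialSum M (λ m → square (a m)) ⊕ partialSum M (λ m → f ⊗ (square (pow f m) ⊕ square (a m)))
    ≈⟨ ⊕-cong (≈-sym (partialSum-square M a)) (≈-sym (partialSum-⊗ M f _)) ⟩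
  square (partialComp T f M) ⊕ f ⊗ partialSum M (λ m → square (pow f m) ⊕ square (a m))
    ≈⟨ ⊕-cong (≈-refl {square (partialComp T f M)}) (⊗-cong (≈-refl {f}) (≈-trans (partialSum-⊕ M _ _)
         (⊕-cong (≈-sym (partialSum-square M (pow f))) (≈-sym (partialSum-square M a))))) ⟩
  square (partialComp T f M) ⊕ f ⊗ (square (partialSum M (pow f)) ⊕ square (partialComp T f M)) ∎
  where
  open ≈-Reasoning
  a : ℕ → Series
  a k = const (T k) ⊗ pow f k

-- From T(C) = X: writing u = 1 + C, the relation X = T(C) = T(C)² + C(G² + T(C)²)
-- with (1+C)G = 1 gives u²X = u²X² + C + Cu²X², i.e. C = Φ(C).  Degree by degree,
-- the truncations at 2(n+1) and n+1 play the role of T(C).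

module ThueMorseInverse (C : Series) (C₀ : C 0 ≡ false) (TC≈X : ∀ n → compose T C n ≡ X n) where

  truncation≃X : ∀ n K → n < K → partialComp T C K ≃[ n ] X
  truncation≃X n K n<K i i≤n = trans (partialComp≃compose T C K i C₀ (≤-<-trans i≤n n<K)) (TC≈X i)

  geometric≃one : ∀ n → (one ⊕ C) ⊗ partialSum (suc n) (pow C) ≃[ n ] one
  geometric≃one n i i≤n = trans (geometric-sum C (suc n) i)
    (trans (cong (one i xor_) (pow-vanish C (suc n) i C₀ (s≤s i≤n))) (xor-identityʳ (one i)))

  -- Φ(C) + C as a combination of the error terms X + S, A + X and uG + 1, where S
  -- is the right-hand side of `thueMorse-partialComp`; a ring identity in X, C, A, G.
  Φ-error : ∀ A G → let u = one ⊕ C in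
    Φ C ⊕ C ≈ (u ⊗ u) ⊗ (X ⊕ (square A ⊕ C ⊗ (square G ⊕ square A))) ⊕ (u ⊗ u) ⊗ square (A ⊕ X)
              ⊕ C ⊗ square (u ⊗ G ⊕ one) ⊕ C ⊗ (u ⊗ u) ⊗ square (A ⊕ X)
  Φ-error A G =
    solve 4 (λ x c a g → let u = con true :+ c in
              x :* (u :* u :+ x :* (u :* (u :* u))) :+ c
              := (u :* u) :* (x :+ (a :* a :+ c :* (g :* g :+ a :* a))) :+ (u :* u) :* ((a :+ x) :* (a :+ x))
                 :+ c :* ((u :* g :+ con true) :* (u :* g :+ con true)) :+ c :* (u :* u) :* ((a :+ x) :* (a :+ x)))
            (λ _ → refl) X C A G

  fixed-point : C ≈ Φ C
  fixed-point n = sym (xor-cancel (Φ C n) (C n) (Φ+C≃0 n ≤-refl))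
    where
    u A G : Series
    u = one ⊕ C
    A = partialComp T C (suc n)
    G = partialSum (suc n) (pow C)
    X+S≃0 : X ⊕ (square A ⊕ C ⊗ (square G ⊕ square A)) ≃[ n ] zeroS
    X+S≃0 = difference-vanishes (≃-trans (≃-sym (truncation≃X n (double (suc n)) (s≤s (m≤n⇒m≤1+n (m≤double n)))))
                                         (≈⇒≃ n (thueMorse-partialComp C (suc n))))
    A+X≃0 : square (A ⊕ X) ≃[ n ] zeroS
    A+X≃0 = vanish-⊗ (A ⊕ X) (difference-vanishes (truncation≃X n (suc n) ≤-refl))
    uG+1≃0 : square (u ⊗ G ⊕ one) ≃[ n ] zeroS
    uG+1≃0 = vanish-⊗ (u ⊗ G ⊕ one) (difference-vanishes (geometric≃one n))
    Φ+C≃0 : Φ C ⊕ C ≃[ n ] zeroS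
    Φ+C≃0 = ≃-trans (≈⇒≃ n (Φ-error A G))
      (⊕-cong≃ (⊕-cong≃ (⊕-cong≃ (vanish-⊗ (u ⊗ u) X+S≃0) (vanish-⊗ (u ⊗ u) A+X≃0))
                        (vanish-⊗ C uG+1≃0))
               (vanish-⊗ (C ⊗ (u ⊗ u)) A+X≃0))

-- With B = Σ bₖ yᵏ, the relations b_{4m} = b_m,
-- b_{4m+1} = b_{2m}, b_{4m+2} = 0, b_{4m+3} = b_{2m+1} give B = B⁴ + yB², i.e.
-- y³D = D⁴ + y³D² for D = yB; below for the truncations of D(f) = Σ bₖ f^{k+1}.

cube : Series → Series
cube f = f ⊗ square f

baumSweetTerm : Series → ℕ → Series
baumSweetTerm f k = const (baumSweet k) ⊗ pow f (suc k)

baumSweetSum : Series → ℕ → Series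
baumSweetSum f K = partialSum K (baumSweetTerm f)

const-pow-double : ∀ b f k → const b ⊗ pow f (double k) ≈ square (const b ⊗ pow f k)
const-pow-double b f k = ≈-trans (⊗-cong (≈-sym (const-idem b)) (pow-double f k))
  (solve 2 (λ c p → (c :* c) :* (p :* p) := (c :* p) :* (c :* p)) (λ _ → refl) (const b) (pow f k))

module BaumSweetQuarter (f : Series) where

  private
    H : ℕ → Series
    H = baumSweetTerm f

    const-cong⊗ : ∀ {a b} g → a ≡ b → const a ⊗ g ≈ const b ⊗ g
    const-cong⊗ g refl = ≈-refl

  term-4m : ∀ m → cube f ⊗ H (double (double m)) ≈ square (square (H m))
  term-4m m = ≈-trans (⊗-cong (≈-refl {cube f}) (const-cong⊗ (pow f (suc (double (double m)))) (baumSweet-4m m)))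
    (≈-trans (solve 3 (λ q c p → (q :* (q :* q)) :* (c :* (q :* p)) := c :* (q :* (q :* (q :* (q :* p)))))
                      (λ _ → refl) f (const (baumSweet m)) (pow f (double (double m))))
    (≈-trans (const-pow-double (baumSweet m) f (double (suc m)))
             (⊗-cong (const-pow-double (baumSweet m) f (suc m)) (const-pow-double (baumSweet m) f (suc m)))))

  term-4m+1 : ∀ m → H (suc (double (double m))) ≈ square (H (double m))
  term-4m+1 m = ≈-trans (const-cong⊗ (pow f (suc (suc (double (double m))))) (baumSweet-odd (double m)))
                        (const-pow-double (baumSweet (double m)) f (suc (double m)))

  term-4m+2 : ∀ m → H (double (suc (double m))) ≈ zeroS
  term-4m+2 m = ≈-trans (const-cong⊗ (pow f (suc (double (suc (double m))))) (baumSweet-4m+2 m))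
                        (mul-zeroˡ (pow f (suc (double (suc (double m))))))

  term-4m+3 : ∀ m → H (suc (double (suc (double m)))) ≈ square (H (suc (double m)))
  term-4m+3 m = ≈-trans (const-cong⊗ (pow f (suc (suc (double (suc (double m)))))) (baumSweet-odd (suc (double m))))
                        (const-pow-double (baumSweet (suc (double m))) f (suc (suc (double m))))

  quarter : ℕ → Series
  quarter m = (H (double (double m)) ⊕ H (suc (double (double m))))
            ⊕ (H (double (suc (double m))) ⊕ H (suc (double (suc (double m)))))

  quarter-eq : ∀ m → cube f ⊗ quarter m ≈
                     square (square (H m)) ⊕ cube f ⊗ square (H (double m) ⊕ H (suc (double m)))
  quarter-eq m = ≈-trans
    (⊗-cong (≈-refl {cube f}) (⊕-cong (⊕-cong (≈-refl {H (double (double m))}) (term-4m+1 m))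
                                      (⊕-cong (term-4m+2 m) (term-4m+3 m))))
    (≈-trans (solve 4 (λ q a h₁ h₃ → q :* ((a :+ h₁ :* h₁) :+ (con false :+ h₃ :* h₃))
                                     := q :* a :+ q :* ((h₁ :+ h₃) :* (h₁ :+ h₃)))
                      (λ _ → refl) (cube f) (H (double (double m))) (H (double m)) (H (suc (double m))))
             (⊕-cong (term-4m m) (≈-refl {cube f ⊗ square (H (double m) ⊕ H (suc (double m)))})))

baumSweet-partialSum : ∀ f M →
  cube f ⊗ baumSweetSum f (double (double M)) ≈
  square (square (baumSweetSum f M)) ⊕ cube f ⊗ square (baumSweetSum f (double M))
baumSweet-partialSum f M = begin
  cube f ⊗ partialSum (double (double M)) H
    ≈⟨ ⊗-cong (≈-refl {cube f}) (≈-trans (partialSum-pairs (double M) H)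
                                         (partialSum-pairs M (λ j → H (double j) ⊕ H (suc (double j))))) ⟩
  cube f ⊗ partialSum M quarter
    ≈⟨ ≈-trans (partialSum-⊗ M (cube f) quarter) (partialSum-cong M quarter-eq) ⟩
  partialSum M (λ m → square (square (H m)) ⊕ cube f ⊗ square (H (double m) ⊕ H (suc (double m))))
    ≈⟨ partialSum-⊕ M _ _ ⟩
  partialSum M (λ m → square (square (H m))) ⊕ partialSum M (λ m → cube f ⊗ square (H (double m) ⊕ H (suc (double m))))
    ≈⟨ ⊕-cong (≈-trans (≈-sym (partialSum-square M (λ m → square (H m))))
                       (⊗-cong (≈-sym (partialSum-square M H)) (≈-sym (partialSum-square M H))))
              (≈-trans (≈-sym (partialSum-⊗ M (cube f) _))
                       (⊗-cong (≈-refl {cube f}) (≈-trans (≈-sym (partialSum-square M _))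
                         (⊗-cong (≈-sym (partialSum-pairs M H)) (≈-sym (partialSum-pairs M H)))))) ⟩
  square (square (partialSum M H)) ⊕ cube f ⊗ square (partialSum (double M) H) ∎
  where
  open ≈-Reasoning
  open BaumSweetQuarter f
  H : ℕ → Series
  H = baumSweetTerm f

-- From D(Q) = X: the quartering identity at f = Q gives Q³X = X⁴ + Q³X², i.e. (1+X)Q³ = X³.

module BaumSweetInverse (Q : Series) (Q₀ : Q 0 ≡ false) (DQ≈X : ∀ n → compose D Q n ≡ X n) where

  -- Since b''₀ = 0, the truncations of D(Q) are the sums of the terms bₖ Q^{k+1}.
  truncation≃X : ∀ n K → n ≤ K → baumSweetSum Q K ≃[ n ] X
  truncation≃X n K n≤K i i≤n = begin
    baumSweetSum Q K i
      ≡⟨ cong (_xor baumSweetSum Q K i) (mul-zeroˡ one i) ⟨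
    (zeroS ⊗ one) i xor baumSweetSum Q K i
      ≡⟨ partialSum-head K (λ k → const (D k) ⊗ pow Q k) i ⟨
    partialComp D Q (suc K) i
      ≡⟨ partialComp≃compose D Q (suc K) i Q₀ (s≤s (≤-trans i≤n n≤K)) ⟩
    compose D Q i
      ≡⟨ DQ≈X i ⟩
    X i ∎
    where open ≡-Reasoning

  -- In degree n, compare the truncations at M = n+1, 2M and 4M, all ≃[ n ] X.
  cube-times-X : cube Q ⊗ X ≈ square (square X) ⊕ cube Q ⊗ square X
  cube-times-X n = agree n ≤-refl
    where
    Hs : ℕ → Series
    Hs = baumSweetSum Q
    ≃X : ∀ K → n ≤ K → Hs K ≃[ n ] X
    ≃X = truncation≃X n
    n≤2M : n ≤ double (suc n)
    n≤2M = m≤n⇒m≤1+n (m≤n⇒m≤1+n (m≤double n))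
    agree : cube Q ⊗ X ≃[ n ] square (square X) ⊕ cube Q ⊗ square X
    agree = ≃-trans (⊗-cong≃ ≃-refl (≃-sym (≃X (double (double (suc n))) (≤-trans n≤2M (m≤double _)))))
      (≃-trans (≈⇒≃ n (baumSweet-partialSum Q (suc n)))
        (⊕-cong≃ (⊗-cong≃ (⊗-cong≃ (≃X (suc n) (n≤1+n n)) (≃X (suc n) (n≤1+n n)))
                          (⊗-cong≃ (≃X (suc n) (n≤1+n n)) (≃X (suc n) (n≤1+n n))))
                 (⊗-cong≃ ≃-refl (⊗-cong≃ (≃X (double (suc n)) n≤2M) (≃X (double (suc n)) n≤2M)))))

  cubic-equation : (one ⊕ X) ⊗ cube Q ≈ pow X 3
  cubic-equation = cancelX (begin
    X ⊗ ((one ⊕ X) ⊗ cube Q)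
      ≈⟨ solve 2 (λ x q → x :* ((con true :+ x) :* q) := q :* x :+ q :* (x :* x)) (λ _ → refl) X (cube Q) ⟩
    cube Q ⊗ X ⊕ cube Q ⊗ square X
      ≈⟨ ⊕-cong cube-times-X (≈-refl {cube Q ⊗ square X}) ⟩
    square (square X) ⊕ cube Q ⊗ square X ⊕ cube Q ⊗ square X
      ≈⟨ solve 2 (λ x q → x :* x :* (x :* x) :+ q :* (x :* x) :+ q :* (x :* x) := x :* x :^ 3)
                 (λ _ → refl) X (cube Q) ⟩
    X ⊗ pow X 3 ∎)
    where open ≈-Reasoning

data EvenOdd : ℕ → Set where
  even : ∀ m → EvenOdd (double m)
  odd  : ∀ m → EvenOdd (suc (double m))

evenOdd : ∀ n → EvenOdd n
evenOdd zero = even 0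
evenOdd (suc n) with evenOdd n
... | even m = odd m
... | odd  m = even (suc m)

one+X-square : ∀ f i → ((one ⊕ X) ⊗ square f) (suc i) ≡ f ⌊ suc i /2⌋
one+X-square f i = trans (mul-distribʳ one X (square f) (suc i))
  (trans (cong₂ _xor_ (mul-identityˡ (square f) (suc i)) (mulX-suc (square f) i)) (by-parity (evenOdd i)))
  where
  by-parity : ∀ {i} → EvenOdd i → square f (suc i) xor square f i ≡ f ⌊ suc i /2⌋
  by-parity (even m) = trans (cong₂ _xor_ (square-odd f m) (square-even f m)) (sym (cong f (suc-double-half m)))
  by-parity (odd m)  = trans (cong₂ _xor_ (square-even f (suc m)) (square-odd f m))
                             (trans (xor-identityʳ (f (suc m))) (sym (cong f (double-half (suc m)))))

cancel-Xᵏ : ∀ k {f} → pow X k ⊗ f ≈ zeroS → f ≈ zeroS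
cancel-Xᵏ zero    {f} Xᵏf≈0 = ≈-trans (≈-sym (mul-identityˡ f)) Xᵏf≈0
cancel-Xᵏ (suc k) {f} Xᵏf≈0 = cancel-Xᵏ k (cancelX (≈-trans (≈-sym (mul-assoc X (pow X k) f))
                                                           (≈-trans Xᵏf≈0 (≈-sym (mul-zeroʳ X)))))

Z : Series → Series
Z Q zero    = false
Z Q (suc k) = Q (suc (suc ⌊ k /2⌋))

module CandidateFixedPoint (Q : Series) (Q₀ : Q 0 ≡ false) (Q₁ : Q 1 ≡ true)
                           (cubic : (one ⊕ X) ⊗ cube Q ≈ pow X 3) where

  X³Z : X ⊗ (X ⊗ (X ⊗ Z Q)) ≈ (one ⊕ X) ⊗ square (Q ⊕ X)
  X³Z zero    = sym (trans (∧-idem (Q 0 xor false)) (trans (xor-identityʳ (Q 0)) Q₀))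
  X³Z (suc i) = trans (mulX-suc (X ⊗ (X ⊗ Z Q)) i) (trans (shifted i) (sym (one+X-square (Q ⊕ X) i)))
    where
    shifted : ∀ i → (X ⊗ (X ⊗ Z Q)) i ≡ (Q ⊕ X) ⌊ suc i /2⌋
    shifted zero                = sym (trans (xor-identityʳ (Q 0)) Q₀)
    shifted (suc zero)          = sym (cong (_xor true) Q₁)
    shifted (suc (suc zero))    = sym (cong (_xor true) Q₁)
    shifted (suc (suc (suc k))) = trans (mulX²-suc (Z Q) (suc k)) (sym (xor-identityʳ (Q (suc (suc ⌊ k /2⌋)))))

  -- X⁹ (Φ(Z) + Z) is the polynomial F in X and X³Z, and F((1+X)(Q+X)²) vanishes
  -- by the cubic equation.
  F : Series → Series
  F w = pow X 4 ⊗ square (pow X 3 ⊕ w) ⊕ pow X 2 ⊗ cube (pow X 3 ⊕ w) ⊕ pow X 6 ⊗ (pow X 3 ⊕ w) ⊕ pow X 9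

  F-cong : ∀ {w w′} → w ≈ w′ → F w ≈ F w′
  F-cong {w} {w′} w≈w′ = ⊕-cong (⊕-cong (⊕-cong (⊗-cong ≈-refl (⊗-cong v≈v′ v≈v′))
                                        (⊗-cong ≈-refl (⊗-cong v≈v′ (⊗-cong v≈v′ v≈v′))))
                                (⊗-cong ≈-refl v≈v′))
                        (≈-refl {pow X 9})
    where
    v≈v′ : pow X 3 ⊕ w ≈ pow X 3 ⊕ w′
    v≈v′ = ⊕-cong (≈-refl {pow X 3}) w≈w′

  X⁹-error : pow X 9 ⊗ (Φ (Z Q) ⊕ Z Q) ≈ zeroS
  X⁹-error = begin
    pow X 9 ⊗ (Φ (Z Q) ⊕ Z Q)
      ≈⟨ solve 2 (λ x z → let w = con true :+ z ; v = x :^ 3 :+ x :* (x :* (x :* z)) in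
                    x :^ 9 :* (x :* (w :* w :+ x :* (w :* (w :* w))) :+ z)
                    := x :^ 4 :* (v :* v) :+ x :^ 2 :* (v :* (v :* v)) :+ x :^ 6 :* v :+ x :^ 9)
                 (λ _ → refl) X (Z Q) ⟩
    F (X ⊗ (X ⊗ (X ⊗ Z Q)))
      ≈⟨ F-cong X³Z ⟩
    F ((one ⊕ X) ⊗ square (Q ⊕ X))
      ≈⟨ solve 2 (λ x q → let v = x :^ 3 :+ (con true :+ x) :* ((q :+ x) :* (q :+ x))
                              e = (con true :+ x) :* (q :* (q :* q)) :+ x :^ 3 in
                    x :^ 4 :* (v :* v) :+ x :^ 2 :* (v :* (v :* v)) :+ x :^ 6 :* v :+ x :^ 9
                    := x :^ 2 :* (con true :+ x) :* (e :* e))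
                 (λ _ → refl) X Q ⟩
    pow X 2 ⊗ (one ⊕ X) ⊗ square ((one ⊕ X) ⊗ cube Q ⊕ pow X 3)
      ≈⟨ ⊗-cong (≈-refl {pow X 2 ⊗ (one ⊕ X)}) (⊗-cong cubic+X³ cubic+X³) ⟩
    pow X 2 ⊗ (one ⊕ X) ⊗ square (pow X 3 ⊕ pow X 3)
      ≈⟨ solve 1 (λ x → x :^ 2 :* (con true :+ x) :* ((x :^ 3 :+ x :^ 3) :* (x :^ 3 :+ x :^ 3)) := con false)
                 (λ _ → refl) X ⟩
    zeroS ∎
    where
    open ≈-Reasoning
    cubic+X³ : (one ⊕ X) ⊗ cube Q ⊕ pow X 3 ≈ pow X 3 ⊕ pow X 3
    cubic+X³ = ⊕-cong cubic (≈-refl {pow X 3})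

  fixed-point : Z Q ≈ Φ (Z Q)
  fixed-point n = sym (xor-cancel (Φ (Z Q) n) (Z Q n) (cancel-Xᵏ 9 {Φ (Z Q) ⊕ Z Q} X⁹-error n))

-- R is causal when R(f) up to degree n only depends
-- on f up to degree n; then coefficient n+1 of X·R(f) only depends on f up to
-- degree n, so X·R has at most one fixed point.

Causal : (Series → Series) → Set
Causal Ψ = ∀ {f g} n → f ≃[ n ] g → Ψ f ≃[ n ] Ψ g

R-causal : Causal R
R-causal {f} {g} n f≃g =
  ⊕-cong≃ (⊗-cong≃ 1+f≃1+g 1+f≃1+g) (⊗-cong≃ {X} ≃-refl (⊗-cong≃ 1+f≃1+g (⊗-cong≃ 1+f≃1+g 1+f≃1+g)))
  where
  1+f≃1+g : one ⊕ f ≃[ n ] one ⊕ g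
  1+f≃1+g = ⊕-cong≃ {one} ≃-refl f≃g

causal-fixed-point-unique : ∀ {Ψ} → Causal Ψ → ∀ {A B} → A ≈ X ⊗ Ψ A → B ≈ X ⊗ Ψ B → A ≈ B
causal-fixed-point-unique {Ψ} causal {A} {B} A≈XΨA B≈XΨB n = agree n n ≤-refl
  where
  agree : ∀ n → A ≃[ n ] B
  agree zero    zero    z≤n = trans (A≈XΨA 0) (sym (B≈XΨB 0))
  agree (suc n) i       i≤1+n with m≤n⇒m<n∨m≡n i≤1+n
  ... | inj₁ (s≤s i≤n) = agree n i i≤n
  ... | inj₂ refl = begin
    A (suc n)          ≡⟨ A≈XΨA (suc n) ⟩
    (X ⊗ Ψ A) (suc n)  ≡⟨ mulX-suc (Ψ A) n ⟩
    Ψ A n              ≡⟨ causal n (agree n) n ≤-refl ⟩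
    Ψ B n              ≡⟨ mulX-suc (Ψ B) n ⟨
    (X ⊗ Ψ B) (suc n)  ≡⟨ B≈XΨB (suc n) ⟨
    B (suc n)          ∎
    where open ≡-Reasoning

module StrictlyIncreasing {s : ℕ → ℕ} (increasing : ∀ n → s n < s (suc n)) where

  monotone : ∀ {i j} → i ≤ j → s i ≤ s j
  monotone {zero}  {zero}  z≤n = ≤-refl
  monotone {i}     {suc j} i≤1+j with m≤n⇒m<n∨m≡n i≤1+j
  ... | inj₁ (s≤s i≤j) = ≤-trans (monotone i≤j) (<⇒≤ (increasing j))
  ... | inj₂ refl      = ≤-refl

  reflects-< : ∀ {i j} → s i < s j → i < j
  reflects-< {i} {j} sᵢ<sⱼ with i <? j
  ... | yes i<j = i<j
  ... | no  i≮j = contradiction (monotone (≮⇒≥ i≮j)) (<⇒≱ sᵢ<sⱼ)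

enum-member : ∀ {P s} → IsIncreasingEnum P s → ∀ n → P (s n)
enum-member (_ , members) n = Equivalence.from (members _) (n , refl)

enum-index : ∀ {P s} → IsIncreasingEnum P s → ∀ {m} → P m → ∃ λ k → s k ≡ m
enum-index (_ , members) = Equivalence.to (members _)

-- If s and s′ enumerate P, the n-th element of s′ occurs in s at an index ≥ n:
-- the indices of s′ 0 < s′ 1 < ⋯ in s are strictly increasing.
enum-late-index : ∀ {P s s′} → IsIncreasingEnum P s → IsIncreasingEnum P s′ →
                  ∀ n → Σ ℕ λ k → n ≤ k × s k ≡ s′ n
enum-late-index E E′ n with enum-index E (enum-member E′ n)
enum-late-index E E′ zero    | k , sₖ≡s′₀ = k , z≤n , sₖ≡s′₀
enum-late-index E E′ (suc n) | k , sₖ≡s′ₙ₊₁ with enum-late-index E E′ n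
... | j , n≤j , sⱼ≡s′ₙ =
  k , ≤-<-trans n≤j (StrictlyIncreasing.reflects-< (proj₁ E)
                       (subst₂ _<_ (sym sⱼ≡s′ₙ) (sym sₖ≡s′ₙ₊₁) (proj₁ E′ n))) , sₖ≡s′ₙ₊₁

enum-≤ : ∀ {P s s′} → IsIncreasingEnum P s → IsIncreasingEnum P s′ → ∀ n → s n ≤ s′ n
enum-≤ {s = s} E E′ n with enum-late-index E E′ n
... | k , n≤k , sₖ≡s′ₙ = subst (s n ≤_) sₖ≡s′ₙ (StrictlyIncreasing.monotone (proj₁ E) n≤k)

enum-unique : ∀ {P s s′} → IsIncreasingEnum P s → IsIncreasingEnum P s′ → ∀ n → s n ≡ s′ n
enum-unique E E′ n = ≤-antisym (enum-≤ E E′ n) (enum-≤ E′ E n)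

enum-cong : ∀ {P P′ s} → (∀ m → P m ⇔ P′ m) → IsIncreasingEnum P s → IsIncreasingEnum P′ s
enum-cong P⇔P′ (increasing , members) = increasing , λ m → ⇔-trans (⇔-sym (P⇔P′ m)) (members m)

module DropFirstTwo {P : ℕ → Set} {s : ℕ → ℕ} (E : IsIncreasingEnum P s) (P0 : P 0) (¬P1 : ¬ P 1) where

  open StrictlyIncreasing (proj₁ E) using (monotone)

  s₀≡0 : s 0 ≡ 0
  s₀≡0 with enum-index E P0
  ... | k , sₖ≡0 = n≤0⇒n≡0 (subst (s 0 ≤_) sₖ≡0 (monotone z≤n))

  2≤s₁ : 2 ≤ s 1
  2≤s₁ with s 1 | enum-member E 1 | subst (_< s 1) s₀≡0 (proj₁ E 0)
  ... | suc zero    | P1 | _ = contradiction P1 ¬P1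
  ... | suc (suc _) | _  | _ = s≤s (s≤s z≤n)

  s≡2+ : ∀ i → s (suc i) ≡ suc (suc (s (suc i) ∸ 2))
  s≡2+ i = sym (2+[m∸2]≡m (≤-trans 2≤s₁ (monotone (s≤s z≤n))))
    where
    2+[m∸2]≡m : ∀ {m} → 2 ≤ m → suc (suc (m ∸ 2)) ≡ m
    2+[m∸2]≡m (s≤s (s≤s _)) = refl

  enum : IsIncreasingEnum (λ j → P (suc (suc j))) (λ i → s (suc i) ∸ 2)
  enum = (λ i → ∸-monoˡ-< (proj₁ E (suc i)) (≤-trans 2≤s₁ (monotone (s≤s z≤n))))
       , λ j → mk⇔ (to j) (from j)
    where
    to : ∀ j → P (suc (suc j)) → ∃ λ i → s (suc i) ∸ 2 ≡ j
    to j p with enum-index E p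
    ... | zero  , s₀≡2+j = contradiction (trans (sym s₀≡2+j) s₀≡0) λ ()
    ... | suc i , e      = i , cong (_∸ 2) e
    from : ∀ j → (∃ λ i → s (suc i) ∸ 2 ≡ j) → P (suc (suc j))
    from j (i , e) = subst P (trans (s≡2+ i) (cong (suc ∘ suc) e)) (enum-member E (suc i))

spread : (ℕ → ℕ) → ℕ → ℕ
spread s n = double (s ⌊ n /2⌋) + n % 2

spread-even : ∀ s i → spread s (double i) ≡ double (s i)
spread-even s i = trans (cong₂ (λ h r → double (s h) + r) (double-half i) (double-mod2 i)) (+-identityʳ _)

spread-odd : ∀ s i → spread s (suc (double i)) ≡ suc (double (s i))
spread-odd s i = trans (cong₂ (λ h r → double (s h) + r) (suc-double-half i) (suc-double-mod2 i)) (+-comm _ 1)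

enum-spread : ∀ {P s} → IsIncreasingEnum P s → IsIncreasingEnum (λ m → P ⌊ m /2⌋) (spread s)
enum-spread {P} {s} E = increasing , λ m → mk⇔ (to (evenOdd m)) from
  where
  increasing : ∀ n → spread s n < spread s (suc n)
  increasing n with evenOdd n
  ... | even i = subst₂ _<_ (sym (spread-even s i)) (sym (spread-odd s i)) (n<1+n _)
  ... | odd  i = subst₂ _<_ (sym (spread-odd s i)) (sym (spread-even s (suc i))) (double-mono-< (proj₁ E i))
  half-spread : ∀ {n} → EvenOdd n → ⌊ spread s n /2⌋ ≡ s ⌊ n /2⌋
  half-spread (even i) =
    trans (cong ⌊_/2⌋ (spread-even s i)) (trans (double-half (s i)) (cong s (sym (double-half i))))
  half-spread (odd i)  =
    trans (cong ⌊_/2⌋ (spread-odd s i)) (trans (suc-double-half (s i)) (cong s (sym (suc-double-half i))))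
  to : ∀ {m} → EvenOdd m → P ⌊ m /2⌋ → ∃ λ n → spread s n ≡ m
  to (even j) p with enum-index E p
  ... | k , e = double k , trans (spread-even s k) (cong double (trans e (double-half j)))
  to (odd j)  p with enum-index E p
  ... | k , e = suc (double k) , trans (spread-odd s k) (cong (suc ∘ double) (trans e (suc-double-half j)))
  from : ∀ {m} → (∃ λ n → spread s n ≡ m) → P ⌊ m /2⌋
  from (n , refl) = subst P (sym (half-spread (evenOdd n))) (enum-member E ⌊ n /2⌋)

enum-suc : ∀ {P s} → IsIncreasingEnum P s → IsIncreasingEnum (λ m → (1 ≤ m) × P (pred m)) (suc ∘ s)
enum-suc {P} {s} E = (λ n → s≤s (proj₁ E n)) , λ m → mk⇔ to from
  where
  to : ∀ {m} → (1 ≤ m) × P (pred m) → ∃ λ n → suc (s n) ≡ m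
  to {suc k} (_ , p) with enum-index E p
  ... | n , e = n , cong suc e
  from : ∀ {m} → (∃ λ n → suc (s n) ≡ m) → (1 ≤ m) × P (pred m)
  from (n , refl) = s≤s z≤n , enum-member E n

even-index : ∀ x → suc (double x) + 3 ≡ 2 * suc (suc x)
even-index x = trans (cong suc (+-comm (double x) 3)) (double≡2* (suc (suc x)))

odd-index : ∀ x → suc (suc (double x)) + 2 ≡ 2 * suc (suc x)
odd-index x = trans (cong (suc ∘ suc) (+-comm (double x) 2)) (double≡2* (suc (suc x)))

zeros-from-Z : ∀ {C Q} (d v : ℕ → ℕ) → C ≈ Z Q → Q 0 ≡ false → Q 1 ≡ true →
  IsIncreasingEnum (λ m → (1 ≤ m) × (C m ≡ false)) d →
  IsIncreasingEnum (λ m → Q m ≡ false) v →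
  ∀ n → (d (2 * n) + 3 ≡ 2 * v (suc n)) × (d (2 * n + 1) + 2 ≡ 2 * v (suc n))
zeros-from-Z {C} {Q} d v C≈Z Q₀ Q₁ Ed Ev n = even-case , odd-case
  where
  zeros-of-C : ∀ m → ((1 ≤ m) × (Q (suc (suc ⌊ pred m /2⌋)) ≡ false)) ⇔ ((1 ≤ m) × (C m ≡ false))
  zeros-of-C zero    = mk⇔ (λ { (() , _) }) (λ { (() , _) })
  zeros-of-C (suc k) = mk⇔ (λ (1≤m , q) → 1≤m , trans (C≈Z (suc k)) q)
                           (λ (1≤m , c) → 1≤m , trans (sym (C≈Z (suc k))) c)

  -- The zeros of Q beyond 1, shifted down by 2, are enumerated by w; hence d = 1 + spread w.
  open DropFirstTwo Ev Q₀ (λ Q₁≡false → contradiction (trans (sym Q₁) Q₁≡false) λ ())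
    using (s≡2+) renaming (enum to Ew)
  w : ℕ → ℕ
  w i = v (suc i) ∸ 2

  d≡ : ∀ k → d k ≡ suc (spread w k)
  d≡ = enum-unique Ed (enum-cong zeros-of-C (enum-suc (enum-spread Ew)))

  even-case : d (2 * n) + 3 ≡ 2 * v (suc n)
  even-case = begin
    d (2 * n) + 3              ≡⟨ cong (λ k → d k + 3) (double≡2* n) ⟨
    d (double n) + 3           ≡⟨ cong (_+ 3) (trans (d≡ (double n)) (cong suc (spread-even w n))) ⟩
    suc (double (w n)) + 3     ≡⟨ even-index (w n) ⟩
    2 * suc (suc (w n))        ≡⟨ cong (2 *_) (s≡2+ n) ⟨
    2 * v (suc n)              ∎
    where open ≡-Reasoning

  odd-case : d (2 * n + 1) + 2 ≡ 2 * v (suc n)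
  odd-case = begin
    d (2 * n + 1) + 2                ≡⟨ cong (λ k → d k + 2) (trans (cong suc (double≡2* n)) (+-comm 1 (2 * n))) ⟨
    d (suc (double n)) + 2           ≡⟨ cong (_+ 2) (trans (d≡ (suc (double n))) (cong suc (spread-odd w n))) ⟩
    suc (suc (double (w n))) + 2     ≡⟨ odd-index (w n) ⟩
    2 * suc (suc (w n))              ≡⟨ cong (2 *_) (s≡2+ n) ⟨
    2 * v (suc n)                    ∎
    where open ≡-Reasoning

mainTheorem13 : (C Q : Series) → IsCompInverse T C → IsCompInverse D Q →
    (d v : ℕ → ℕ) →
    IsIncreasingEnum (λ m → (1 ≤ m) × (C m ≡ false)) d →
    IsIncreasingEnum (λ m → Q m ≡ false) v →
    ∀ n → (d (2 * n) + 3 ≡ 2 * v (suc n)) × (d (2 * n + 1) + 2 ≡ 2 * v (suc n))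
mainTheorem13 C Q (C₀ , TC≈X , _) (Q₀ , DQ≈X , _) d v = zeros-from-Z d v C≈Z Q₀ Q₁
  where
  -- [X¹] D(Q) = b''₁ Q₁ = Q₁.
  Q₁ : Q 1 ≡ true
  Q₁ = trans (sym (mul-identityʳ Q 1)) (DQ≈X 1)

  -- C = Φ(C) by (1); Z(Q) = Φ(Z(Q)) by (2) and (3); Φ has a unique fixed point (4).
  C≈Z : C ≈ Z Q
  C≈Z = causal-fixed-point-unique R-causal (ThueMorseInverse.fixed-point C C₀ TC≈X)
          (CandidateFixedPoint.fixed-point Q Q₀ Q₁ (BaumSweetInverse.cubic-equation Q Q₀ DQ≈X))
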